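{- Let $X$ be a Gamma-LD graph. (a) If $X\gg(\ )$ then $(X)$ is valid. (b) If $(X)\gg(\ )$ then $X$ is valid. (c) If $\underline X$ is an alternate graph with $\underline X\gg[\ ]$, then $[\underline X]$ is valid.
   Context: Gamma-LD graphs: built from the empty graph $\lambda$ and atoms (classical atoms $a,b,\dots$ and alternate atoms $\underline a,\underline b,\dots$) by juxtaposition $XY$ (commutative, associative), classical cut $(X)$ and alternate cut $[X]$; $(\ )$ and $[\ ]$ denote empty cuts. Alternate graphs $\underline X$: alternate atoms or graphs $[Y]$. An occurrence lies in an even (odd) region if enclosed by an even (odd) number of cuts of either kind, and in a classical region if enclosed by no alternate cut. A rule $X\Rightarrow Y$ (with a region condition) allows replacing an occurrence of $X$ satisfying the condition by $Y$; $\Leftrightarrow$ means both directions anywhere. Rules: R$\lambda$: $\lambda$ valid; $XY$ in even region $\Rightarrow X$ or $Y$; $X$ in odd region $\Rightarrow XY$ or $YX$; $X\Leftrightarrow((X))$; $[X]$ in even region $\Rightarrow(X)$ and $(X)$ in odd region $\Rightarrow[X]$; if $X$ is valid, $X\Leftrightarrow[(X)]$; $\underline X$ in even region $\Rightarrow[(\underline X)]$ and $[(\underline X)]$ in odd region $\Rightarrow\underline X$; $X\Rightarrow XX$; $XX\Rightarrow X$; $X\,G_n(Y)\Leftrightarrow X\,G_n(XY)$ for $X,Y$ in classical regions, where $G_0(Y)=Y_0Y$, $G_{k+1}(Y)=Y_{k+1}(G_k(Y))$; $\underline X\,H_n(Y)\Leftrightarrow\underline X\,H_n(\underline XY)$ where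 $H_0(Y)=Y_0Y$, $H_{k+1}(Y)=Y_{k+1}\{H_k(Y)\}$ with each $\{\cdot\}$ a classical or alternate cut. $X\gg Z$ means $X$ is transformed into $Z$ by finitely many rule applications; $X$ is valid if $\lambda\gg X$. -}

module Defs where

open import Data.Nat using (ℕ)
open import Data.Bool using (Bool; true; false; not; _∧_)
open import Data.List using (List; []; _∷_; _++_)
open import Data.List.Relation.Binary.Permutation.Propositional using (_↭_)
open import Relation.Binary.PropositionalEquality using (_≡_)

-- A graph is a juxtaposition of items; juxtaposition is list
-- concatenation, and commutativity is handled by a permutation rule
-- (identity of graphs up to reordering).

mutual
  data Item : Set where
    catom : ℕ → Item
    aatom : ℕ → Item
    ccut  : Graph → Item
    acut  : Graph → Item

  Graph : Set
  Graph = List Item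

λ-graph : Graph
λ-graph = []

data IsAlt : Item → Set where
  alt-atom : ∀ a → IsAlt (aatom a)
  alt-cut  : ∀ Y → IsAlt (acut Y)

data Ctx : Set where
  hole  : Ctx
  juxt  : Graph → Ctx → Graph → Ctx
  cctx  : Ctx → Ctx
  actx  : Ctx → Ctx

fill : Ctx → Graph → Graph
fill hole      X = X
fill (juxt Z C W) X = Z ++ (fill C X ++ W)
fill (cctx C)  X = ccut (fill C X) ∷ []
fill (actx C)  X = acut (fill C X) ∷ []

evenR : Ctx → Bool
evenR hole = true
evenR (juxt _ C _) = evenR C
evenR (cctx C) = not (evenR C)
evenR (actx C) = not (evenR C)

classicalR : Ctx → Bool
classicalR hole = true
classicalR (juxt _ C _) = classicalR C
classicalR (cctx C) = classicalR C
classicalR (actx C) = false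

data GNest : Set where
  gbase : Graph → GNest
  gstep : Graph → GNest → GNest

gfill : GNest → Graph → Graph
gfill (gbase Y₀) Y = Y₀ ++ Y
gfill (gstep Yₖ N) Y = Yₖ ++ (ccut (gfill N Y) ∷ [])

data CutKind : Set where
  classical alternate : CutKind

cutOf : CutKind → Graph → Item
cutOf classical X = ccut X
cutOf alternate X = acut X

data HNest : Set where
  hbase : Graph → HNest
  hstep : CutKind → Graph → HNest → HNest

hfill : HNest → Graph → Graph
hfill (hbase Y₀) Y = Y₀ ++ Y
hfill (hstep k Yₖ N) Y = Yₖ ++ (cutOf k (hfill N Y) ∷ [])

-- One rule application (_⟶_) and transformation (_≫_), mutually with
-- validity (needed by the rule  X ⇔ [(X)]  for valid X).

infix 4 _⟶_ _≫_

mutual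
  data _⟶_ : Graph → Graph → Set where
    perm      : ∀ C {X Y} → X ↭ Y → fill C X ⟶ fill C Y
    -- XY in even region ⇒ X  (⇒ Y is obtained via perm)
    erase     : ∀ C X Y → evenR C ≡ true → fill C (X ++ Y) ⟶ fill C X
    -- X in odd region ⇒ XY  (YX via perm)
    insert    : ∀ C X Y → evenR C ≡ false → fill C X ⟶ fill C (X ++ Y)
    dcut-in   : ∀ C X → fill C X ⟶ fill C (ccut (ccut X ∷ []) ∷ [])
    dcut-out  : ∀ C X → fill C (ccut (ccut X ∷ []) ∷ []) ⟶ fill C X
    a→c       : ∀ C X → evenR C ≡ true → fill C (acut X ∷ []) ⟶ fill C (ccut X ∷ [])
    c→a       : ∀ C X → evenR C ≡ false → fill C (ccut X ∷ []) ⟶ fill C (acut X ∷ [])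
    valid-in  : ∀ C X → [] ≫ X → fill C X ⟶ fill C (acut (ccut X ∷ []) ∷ [])
    valid-out : ∀ C X → [] ≫ X → fill C (acut (ccut X ∷ []) ∷ []) ⟶ fill C X
    alt-in    : ∀ C x → IsAlt x → evenR C ≡ true →
                fill C (x ∷ []) ⟶ fill C (acut (ccut (x ∷ []) ∷ []) ∷ [])
    alt-out   : ∀ C x → IsAlt x → evenR C ≡ false →
                fill C (acut (ccut (x ∷ []) ∷ []) ∷ []) ⟶ fill C (x ∷ [])
    dup       : ∀ C X → fill C X ⟶ fill C (X ++ X)
    contr     : ∀ C X → fill C (X ++ X) ⟶ fill C X
    iter      : ∀ C X N Y → classicalR C ≡ true →
                fill C (X ++ gfill N Y) ⟶ fill C (X ++ gfill N (X ++ Y))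
    deiter    : ∀ C X N Y → classicalR C ≡ true →
                fill C (X ++ gfill N (X ++ Y)) ⟶ fill C (X ++ gfill N Y)
    alt-iter   : ∀ C x → IsAlt x → ∀ N Y →
                 fill C (x ∷ hfill N Y) ⟶ fill C (x ∷ hfill N (x ∷ Y))
    alt-deiter : ∀ C x → IsAlt x → ∀ N Y →
                 fill C (x ∷ hfill N (x ∷ Y)) ⟶ fill C (x ∷ hfill N Y)

  data _≫_ : Graph → Graph → Set where
    done : ∀ {X} → X ≫ X
    step : ∀ {X Y Z} → X ⟶ Y → Y ≫ Z → X ≫ Z

Valid : Graph → Set
Valid X = λ-graph ≫ X

{-# OPTIONS --safe #-}
module Submission where

-- Enclosing a derivation in a classical cut turns every even region into an
-- odd one and vice versa, so each rule application X ⟶ Y is matched by its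
-- converse rule (Y) ⟶ (X); hence X ≫ Z yields (Z) ≫ (X). Since (()) and,
-- one rule later, ([]) are valid, (a) and (b) follow from X ≫ () and
-- (X) ≫ (), and (c) from x ≫ [] after wrapping the valid graph (x) as [((x))].
-- Nothing here needs x to be alternate.

open import Defs
open import Data.Product using (_×_; _,_)
open import Data.List using ([]; _∷_)
open import Data.Bool using (true; false; not)
open import Relation.Binary.PropositionalEquality using (_≡_; refl)
open import Data.List.Relation.Binary.Permutation.Propositional using (↭-sym)

not-true : ∀ {b} → b ≡ true → not b ≡ false
not-true refl = refl

not-false : ∀ {b} → b ≡ false → not b ≡ true
not-false refl = refl

⟶-contrapose : ∀ {X Y} → X ⟶ Y → (ccut Y ∷ []) ⟶ (ccut X ∷ [])
⟶-contrapose (perm C p)             = perm (cctx C) (↭-sym p)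
⟶-contrapose (erase C X Y e)        = insert (cctx C) X Y (not-true e)
⟶-contrapose (insert C X Y e)       = erase (cctx C) X Y (not-false e)
⟶-contrapose (dcut-in C X)          = dcut-out (cctx C) X
⟶-contrapose (dcut-out C X)         = dcut-in (cctx C) X
⟶-contrapose (a→c C X e)            = c→a (cctx C) X (not-true e)
⟶-contrapose (c→a C X e)            = a→c (cctx C) X (not-false e)
⟶-contrapose (valid-in C X v)       = valid-out (cctx C) X v
⟶-contrapose (valid-out C X v)      = valid-in (cctx C) X v
⟶-contrapose (alt-in C x a e)       = alt-out (cctx C) x a (not-true e)
⟶-contrapose (alt-out C x a e)      = alt-in (cctx C) x a (not-false e)
⟶-contrapose (dup C X)              = contr (cctx C) X
⟶-contrapose (contr C X)            = dup (cctx C) X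
⟶-contrapose (iter C X N Y e)       = deiter (cctx C) X N Y e
⟶-contrapose (deiter C X N Y e)     = iter (cctx C) X N Y e
⟶-contrapose (alt-iter C x a N Y)   = alt-deiter (cctx C) x a N Y
⟶-contrapose (alt-deiter C x a N Y) = alt-iter (cctx C) x a N Y

≫-trans : ∀ {X Y Z} → X ≫ Y → Y ≫ Z → X ≫ Z
≫-trans done       q = q
≫-trans (step s p) q = step s (≫-trans p q)

≫-snoc : ∀ {X Y Z} → X ≫ Y → Y ⟶ Z → X ≫ Z
≫-snoc p s = ≫-trans p (step s done)

≫-contrapose : ∀ {X Y} → X ≫ Y → (ccut Y ∷ []) ≫ (ccut X ∷ [])
≫-contrapose done       = done
≫-contrapose (step s p) = ≫-snoc (≫-contrapose p) (⟶-contrapose s)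

valid-double-empty-cut : Valid (ccut (ccut [] ∷ []) ∷ [])
valid-double-empty-cut = step (dcut-in hole []) done

valid-cut-empty-alt-cut : Valid (ccut (acut [] ∷ []) ∷ [])
valid-cut-empty-alt-cut = ≫-snoc valid-double-empty-cut (c→a (cctx hole) [] refl)

mainTheorem12 : (∀ (X : Graph) → X ≫ (ccut [] ∷ []) → Valid (ccut X ∷ []))
    × (∀ (X : Graph) → (ccut X ∷ []) ≫ (ccut [] ∷ []) → Valid X)
    × (∀ (x : Item) → IsAlt x → (x ∷ []) ≫ (acut [] ∷ []) → Valid (acut (x ∷ []) ∷ []))
mainTheorem12 = part-a , part-b , part-c
  where
  part-a : ∀ X → X ≫ (ccut [] ∷ []) → Valid (ccut X ∷ [])
  part-a X p = ≫-trans valid-double-empty-cut (≫-contrapose p)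

  part-b : ∀ X → (ccut X ∷ []) ≫ (ccut [] ∷ []) → Valid X
  part-b X p = ≫-snoc (part-a (ccut X ∷ []) p) (dcut-out hole X)

  part-c : ∀ x → IsAlt x → (x ∷ []) ≫ (acut [] ∷ []) → Valid (acut (x ∷ []) ∷ [])
  part-c x _ p = ≫-snoc (≫-snoc valid-cut-x (valid-in hole (ccut (x ∷ []) ∷ []) valid-cut-x))
                        (dcut-out (actx hole) (x ∷ []))
    where
    valid-cut-x : Valid (ccut (x ∷ []) ∷ [])
    valid-cut-x = ≫-trans valid-cut-empty-alt-cut (≫-contrapose p)
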